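{- Let $U$ be any finite set and $P \subseteq \binom{U}{2}$ be any set of pairs of elements of $U$ such that each element of $U$ appears in at most $q$ pairs of $P$. For any integer $r$ with $2 \le r \le |U|$, the probability that a uniformly random element of $\binom{U}{r}$ does not contain both elements of any pair in $P$ is at most $\exp\left(-\frac{|P| r^2}{4q|U|^2}\right)$.
   Context: For a set $S$ and integer $0\le t\le |S|$, $\binom{S}{t}$ denotes the collection of all $t$-element subsets of $S$. $\exp(x)=e^x$. -}

module Defs where

open import Data.Bool using (Bool; true; false; not; _∧_; _∨_)
open import Data.Nat using (ℕ; zero; suc; _+_; _*_)
open import Data.Nat using (_!)
open import Data.Fin using (Fin; toℕ)
open import Data.Fin.Subset using (Subset; inside; outside; ∣_∣)
open import Data.Vec using ([]; _∷_; lookup)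
open import Data.List using (List; []; _∷_; _++_; map; filterᵇ; length)
open import Data.Bool.ListAction using (all)
open import Data.Product using (_×_; _,_; proj₁; proj₂)
open import Data.Integer using (+_)
open import Data.Rational using (ℚ; 0ℚ; 1ℚ; _/_) renaming (_+_ to _+ℚ_; _*_ to _*ℚ_)
open import Relation.Nullary.Decidable using (⌊_⌋)
import Data.Fin as F
import Data.Nat as N

allSubsets : (n : ℕ) → List (Subset n)
allSubsets zero = [] ∷ []
allSubsets (suc n) = map (inside ∷_) (allSubsets n) ++ map (outside ∷_) (allSubsets n)

rSubsets : (n r : ℕ) → List (Subset n)
rSubsets n r = filterᵇ (λ s → ⌊ ∣ s ∣ N.≟ r ⌋) (allSubsets n)

avoids : {n : ℕ} → List (Fin n × Fin n) → Subset n → Bool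
avoids P s = all (λ p → not (lookup s (proj₁ p) ∧ lookup s (proj₂ p))) P

degree : {n : ℕ} → List (Fin n × Fin n) → Fin n → ℕ
degree P u = length (filterᵇ (λ p → ⌊ proj₁ p F.≟ u ⌋ ∨ ⌊ proj₂ p F.≟ u ⌋) P)

-- a / b as a rational (b = 0 is never used under the hypotheses; returns 0)
frac : ℕ → ℕ → ℚ
frac a zero = 0ℚ
frac a (suc b) = (+ a) / suc b

powℚ : ℚ → ℕ → ℚ
powℚ x zero = 1ℚ
powℚ x (suc k) = x *ℚ powℚ x k

expPartial : ℚ → ℕ → ℚ
expPartial x zero = 1ℚ
expPartial x (suc N) = expPartial x N +ℚ (powℚ x (suc N) *ℚ frac 1 ((suc N) !))

-- Greedily extract from P a matching of m ≥ |P|/(2q) pairs; an r-set avoiding P avoids it.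
-- For a family of subsets closed under removing elements and ignoring two points a ≠ b,
-- two applications of the local LYM inequality show that at least a fraction
-- y = r(r − 1)/(n(n − 1)) of its r-sets contain both a and b.  Adding the pairs of the matching
-- one at a time, the proportion of r-sets avoiding all of them is therefore at most (1 − y)^m.
-- Finally (1 − y)^m · Σ_{j ≤ M} (m y)^j / j! ≤ 1, because (m y)^j / j! ≤ C(m + j − 1, j) y^j and
-- (1 − y)^m · Σ_j C(m + j − 1, j) y^j ≤ 1 (negative binomial series), while |P| r²/(4qn²) ≤ m y.

module Submission where

open import Defs

module Multichoose where

  open import Data.Nat.Base using (ℕ; zero; suc; _+_; _*_; _^_; _!; _≤_)
  open import Data.Nat.Properties
  open import Data.Nat.Tactic.RingSolver using (solve-∀)
  open import Algebra.Properties.CommutativeSemigroup *-commutativeSemigroup using (xy∙z≈y∙xz)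
  open import Relation.Binary.PropositionalEquality

  multichoose : ℕ → ℕ → ℕ
  multichoose m       zero    = 1
  multichoose zero    (suc j) = 0
  multichoose (suc m) (suc j) = multichoose m (suc j) + multichoose (suc m) j

  multichoose-1 : ∀ m → multichoose m 1 ≡ m
  multichoose-1 zero    = refl
  multichoose-1 (suc m) = trans (cong (_+ 1) (multichoose-1 m)) (+-comm m 1)

  -- so j! · multichoose m j is the rising factorial m (m + 1) ⋯ (m + j − 1)
  *-multichoose-suc : ∀ m j → suc j * multichoose m (suc j) ≡ (m + j) * multichoose m j
  *-multichoose-suc zero    zero    = refl
  *-multichoose-suc zero    (suc j) = trans (*-zeroʳ (2 + j)) (sym (*-zeroʳ (suc j)))
  *-multichoose-suc (suc m) zero    = begin
    1 * (multichoose m 1 + 1) ≡⟨ cong (λ k → 1 * (k + 1)) (multichoose-1 m) ⟩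
    1 * (m + 1)               ≡⟨ rearrange m ⟩
    (suc m + 0) * 1           ∎
    where
    open ≡-Reasoning
    rearrange : ∀ m → 1 * (m + 1) ≡ (suc m + 0) * 1
    rearrange = solve-∀
  *-multichoose-suc (suc m) (suc j) = begin
    (2 + j) * (a + b)                     ≡⟨ *-distribˡ-+ (2 + j) a b ⟩
    (2 + j) * a + (b + suc j * b)         ≡⟨ cong₂ (λ x y → x + (b + y)) (*-multichoose-suc m (suc j)) (*-multichoose-suc (suc m) j) ⟩
    (m + suc j) * c + ((c + d) + (suc m + j) * d) ≡⟨ regroup m j c d ⟩
    (suc m + suc j) * (c + d)             ∎
    where
    open ≡-Reasoning
    a b c d : ℕ
    a = multichoose m (2 + j)
    b = multichoose (suc m) (suc j)
    c = multichoose m (suc j)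
    d = multichoose (suc m) j
    regroup : ∀ m j c d → (m + suc j) * c + ((c + d) + (suc m + j) * d) ≡ (suc m + suc j) * (c + d)
    regroup = solve-∀

  m^j≤multichoose*j! : ∀ m j → m ^ j ≤ multichoose m j * j !
  m^j≤multichoose*j! m zero    = ≤-refl
  m^j≤multichoose*j! m (suc j) = begin
    m * m ^ j                             ≤⟨ *-mono-≤ (m≤m+n m j) (m^j≤multichoose*j! m j) ⟩
    (m + j) * (multichoose m j * j !)     ≡⟨ sym (*-assoc (m + j) _ _) ⟩
    (m + j) * multichoose m j * j !       ≡⟨ cong (_* j !) (sym (*-multichoose-suc m j)) ⟩
    suc j * multichoose m (suc j) * j !   ≡⟨ xy∙z≈y∙xz (suc j) (multichoose m (suc j)) (j !) ⟩
    multichoose m (suc j) * (suc j * j !) ∎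
    where open ≤-Reasoning

module TruncatedExponential where

  open import Data.Nat.Base as ℕ using (ℕ; zero; suc; _!; z≤n; s≤s)
  import Data.Nat.Properties as ℕ
  open import Data.Integer.Base as ℤ using (+_)
  import Data.Integer.Properties as ℤ
  open import Data.Rational.Base
  open import Data.Rational.Properties
  open import Data.Rational.Unnormalised.Base as ℚᵘ using (mkℚᵘ; *≡*; *≤*)
  import Data.Rational.Unnormalised.Properties as ℚᵘ
  open import Data.Rational.Solver using (module +-*-Solver)
  open +-*-Solver using (solve; _:+_; _:*_; _:-_; _:=_; con)
  open import Algebra.Bundles using (CommutativeMonoid)
  open import Algebra.Properties.CommutativeSemigroup (CommutativeMonoid.commutativeSemigroup *-1-commutativeMonoid)
    using (interchange; xy∙z≈y∙xz; xy∙z≈xz∙y)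
  open import Relation.Binary.PropositionalEquality
  open Multichoose using (multichoose; m^j≤multichoose*j!)

  private
    frac≃mkℚᵘ : ∀ a d → toℚᵘ (frac a (suc d)) ℚᵘ.≃ mkℚᵘ (+ a) d
    frac≃mkℚᵘ a d = toℚᵘ-fromℚᵘ (mkℚᵘ (+ a) d)

  frac-mono : ∀ a b d e → 0 ℕ.< d → 0 ℕ.< e → a ℕ.* e ℕ.≤ b ℕ.* d → frac a d ≤ frac b e
  frac-mono a b (suc d) (suc e) _ _ ae≤bd = toℚᵘ-cancel-≤
    (ℚᵘ.≤-respˡ-≃ (ℚᵘ.≃-sym (frac≃mkℚᵘ a d)) (ℚᵘ.≤-respʳ-≃ (ℚᵘ.≃-sym (frac≃mkℚᵘ b e))
      (*≤* (subst₂ ℤ._≤_ (ℤ.pos-* a (suc e)) (ℤ.pos-* b (suc d)) (ℤ.+≤+ ae≤bd)))))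

  frac-cong : ∀ a b d e → 0 ℕ.< d → 0 ℕ.< e → a ℕ.* e ≡ b ℕ.* d → frac a d ≡ frac b e
  frac-cong a b d e 0<d 0<e ae≡bd = ≤-antisym
    (frac-mono a b d e 0<d 0<e (ℕ.≤-reflexive ae≡bd)) (frac-mono b a e d 0<e 0<d (ℕ.≤-reflexive (sym ae≡bd)))

  frac-* : ∀ a b d e → 0 ℕ.< d → 0 ℕ.< e → frac a d * frac b e ≡ frac (a ℕ.* b) (d ℕ.* e)
  frac-* a b (suc d) (suc e) _ _ = toℚᵘ-injective
    (ℚᵘ.≃-trans (toℚᵘ-homo-* (frac a (suc d)) (frac b (suc e)))
    (ℚᵘ.≃-trans (ℚᵘ.*-cong (frac≃mkℚᵘ a d) (frac≃mkℚᵘ b e))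
    (ℚᵘ.≃-trans (*≡* (cong (ℤ._* (+ (suc d ℕ.* suc e))) (sym (ℤ.pos-* a b))))
      (ℚᵘ.≃-sym (frac≃mkℚᵘ (a ℕ.* b) _)))))

  frac-+ : ∀ a b d e → 0 ℕ.< d → 0 ℕ.< e →
           frac a d + frac b e ≡ frac (a ℕ.* e ℕ.+ b ℕ.* d) (d ℕ.* e)
  frac-+ a b (suc d) (suc e) _ _ = toℚᵘ-injective
    (ℚᵘ.≃-trans (toℚᵘ-homo-+ (frac a (suc d)) (frac b (suc e)))
    (ℚᵘ.≃-trans (ℚᵘ.+-cong (frac≃mkℚᵘ a d) (frac≃mkℚᵘ b e))
    (ℚᵘ.≃-trans (*≡* (cong (ℤ._* (+ (suc d ℕ.* suc e))) (sym numerator≡)))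
      (ℚᵘ.≃-sym (frac≃mkℚᵘ (a ℕ.* suc e ℕ.+ b ℕ.* suc d) _)))))
    where
    numerator≡ : + (a ℕ.* suc e ℕ.+ b ℕ.* suc d) ≡ + a ℤ.* + suc e ℤ.+ + b ℤ.* + suc d
    numerator≡ = trans (ℤ.pos-+ (a ℕ.* suc e) _) (cong₂ ℤ._+_ (ℤ.pos-* a (suc e)) (ℤ.pos-* b (suc d)))

  frac-nonNeg : ∀ a d → 0ℚ ≤ frac a d
  frac-nonNeg a zero    = ≤-refl
  frac-nonNeg a (suc d) = frac-mono 0 a 1 (suc d) (s≤s z≤n) (s≤s z≤n) z≤n

  fromℕ : ℕ → ℚ
  fromℕ n = frac n 1

  fromℕ-+ : ∀ a b → fromℕ (a ℕ.+ b) ≡ fromℕ a + fromℕ b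
  fromℕ-+ a b = sym (trans (frac-+ a b 1 1 (s≤s z≤n) (s≤s z≤n))
    (cong (λ k → frac k 1) (cong₂ ℕ._+_ (ℕ.*-identityʳ a) (ℕ.*-identityʳ b))))

  fromℕ-*-frac : ∀ a b d → 0 ℕ.< d → fromℕ a * frac b d ≡ frac (a ℕ.* b) d
  fromℕ-*-frac a b d 0<d = trans (frac-* a b 1 d (s≤s z≤n) 0<d) (cong (frac (a ℕ.* b)) (ℕ.*-identityˡ d))

  frac≤fromℕ : ∀ a b d → 0 ℕ.< d → a ℕ.≤ b ℕ.* d → frac a d ≤ fromℕ b
  frac≤fromℕ a b d 0<d a≤bd = frac-mono a b d 1 0<d (s≤s z≤n) (subst (ℕ._≤ b ℕ.* d) (sym (ℕ.*-identityʳ a)) a≤bd)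

  *-nonNeg : ∀ {p q} → 0ℚ ≤ p → 0ℚ ≤ q → 0ℚ ≤ p * q
  *-nonNeg {p} {q} 0≤p 0≤q = nonNegative⁻¹ (p * q) {{nonNeg*nonNeg⇒nonNeg p {{nonNegative 0≤p}} q {{nonNegative 0≤q}}}}

  p≤p+q : ∀ p {q} → 0ℚ ≤ q → p ≤ p + q
  p≤p+q p {q} 0≤q = subst (_≤ p + q) (+-identityʳ p) (+-monoʳ-≤ p 0≤q)

  p≤q⇒0≤q-p : ∀ {p q} → p ≤ q → 0ℚ ≤ q - p
  p≤q⇒0≤q-p {p} {q} p≤q = subst (_≤ q - p) (+-inverseʳ p) (+-monoˡ-≤ (- p) p≤q)

  powℚ-nonNeg : ∀ {x} j → 0ℚ ≤ x → 0ℚ ≤ powℚ x j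
  powℚ-nonNeg zero    _   = frac-nonNeg 1 1
  powℚ-nonNeg (suc j) 0≤x = *-nonNeg 0≤x (powℚ-nonNeg j 0≤x)

  powℚ-mono : ∀ {x y} j → 0ℚ ≤ x → x ≤ y → powℚ x j ≤ powℚ y j
  powℚ-mono zero    _   _   = ≤-refl
  powℚ-mono {x} {y} (suc j) 0≤x x≤y = ≤-trans
    (*-monoʳ-≤-nonNeg (powℚ x j) {{nonNegative (powℚ-nonNeg j 0≤x)}} x≤y)
    (*-monoˡ-≤-nonNeg y {{nonNegative (≤-trans 0≤x x≤y)}} (powℚ-mono j 0≤x x≤y))

  powℚ-*-distrib : ∀ x y j → powℚ (x * y) j ≡ powℚ x j * powℚ y j
  powℚ-*-distrib x y zero    = sym (*-identityʳ 1ℚ)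
  powℚ-*-distrib x y (suc j) = trans (cong ((x * y) *_) (powℚ-*-distrib x y j)) (interchange x y (powℚ x j) (powℚ y j))

  powℚ-fromℕ : ∀ m j → powℚ (fromℕ m) j ≡ fromℕ (m ℕ.^ j)
  powℚ-fromℕ m zero    = refl
  powℚ-fromℕ m (suc j) = trans (cong (fromℕ m *_) (powℚ-fromℕ m j)) (fromℕ-*-frac m (m ℕ.^ j) 1 (s≤s z≤n))

  powℚ-frac : ∀ a d j → 0 ℕ.< d → powℚ (frac a d) j ≡ frac (a ℕ.^ j) (d ℕ.^ j)
  powℚ-frac a d zero    _   = refl
  powℚ-frac a d (suc j) 0<d = trans (cong (frac a d *_) (powℚ-frac a d j 0<d))
    (frac-* a (a ℕ.^ j) d (d ℕ.^ j) 0<d (ℕ.m^n>0 d {{ℕ.>-nonZero 0<d}} j))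

  expPartial-nonNeg : ∀ {x} M → 0ℚ ≤ x → 0ℚ ≤ expPartial x M
  expPartial-nonNeg zero    _   = frac-nonNeg 1 1
  expPartial-nonNeg (suc M) 0≤x = ≤-trans (expPartial-nonNeg M 0≤x)
    (p≤p+q _ (*-nonNeg (powℚ-nonNeg (suc M) 0≤x) (frac-nonNeg 1 (suc M !))))

  expPartial-mono : ∀ {x y} M → 0ℚ ≤ x → x ≤ y → expPartial x M ≤ expPartial y M
  expPartial-mono zero    _   _   = ≤-refl
  expPartial-mono (suc M) 0≤x x≤y = +-mono-≤ (expPartial-mono M 0≤x x≤y)
    (*-monoʳ-≤-nonNeg (frac 1 (suc M !)) {{nonNegative (frac-nonNeg 1 (suc M !))}} (powℚ-mono (suc M) 0≤x x≤y))

  -- Σ_{j ≤ M} multichoose m j · y^j, the truncated power series of (1 − y)^(−m)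
  negBinomial : ℚ → ℕ → ℕ → ℚ
  negBinomial y m zero    = 1ℚ
  negBinomial y m (suc M) = negBinomial y m M + fromℕ (multichoose m (suc M)) * powℚ y (suc M)

  negBinomial-zero : ∀ y M → negBinomial y 0 M ≡ 1ℚ
  negBinomial-zero y zero    = refl
  negBinomial-zero y (suc M) =
    trans (cong₂ _+_ (negBinomial-zero y M) (*-zeroˡ (powℚ y (suc M)))) (+-identityʳ 1ℚ)

  negBinomial-telescope : ∀ y m M →
    (1ℚ - y) * negBinomial y (suc m) M + fromℕ (multichoose (suc m) M) * powℚ y (suc M) ≡ negBinomial y m M
  negBinomial-telescope y m zero    =
    solve 1 (λ y → (con 1ℚ :- y) :* con 1ℚ :+ con 1ℚ :* (y :* con 1ℚ) := con 1ℚ) refl y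
  negBinomial-telescope y m (suc M) = begin
    (1ℚ - y) * (N + fromℕ (a ℕ.+ b) * Y) + fromℕ (a ℕ.+ b) * (y * Y)
      ≡⟨ cong (λ c → (1ℚ - y) * (N + c * Y) + c * (y * Y)) (fromℕ-+ a b) ⟩
    (1ℚ - y) * (N + (fromℕ a + fromℕ b) * Y) + (fromℕ a + fromℕ b) * (y * Y)
      ≡⟨ solve 5 (λ y N Y A B → (con 1ℚ :- y) :* (N :+ (A :+ B) :* Y) :+ (A :+ B) :* (y :* Y)
                               := ((con 1ℚ :- y) :* N :+ B :* Y) :+ A :* Y) refl y N Y (fromℕ a) (fromℕ b) ⟩
    ((1ℚ - y) * N + fromℕ b * Y) + fromℕ a * Y
      ≡⟨ cong (_+ fromℕ a * Y) (negBinomial-telescope y m M) ⟩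
    negBinomial y m M + fromℕ a * Y ∎
    where
    open ≡-Reasoning
    N Y : ℚ
    a b : ℕ
    N = negBinomial y (suc m) M
    Y = powℚ y (suc M)
    a = multichoose m (suc M)
    b = multichoose (suc m) M

  negBinomial-bound : ∀ {y} m M → 0ℚ ≤ y → y ≤ 1ℚ → powℚ (1ℚ - y) m * negBinomial y m M ≤ 1ℚ
  negBinomial-bound {y} zero    M _   _   = ≤-reflexive (trans (*-identityˡ _) (negBinomial-zero y M))
  negBinomial-bound {y} (suc m) M 0≤y y≤1 = begin
    ((1ℚ - y) * T) * negBinomial y (suc m) M   ≡⟨ xy∙z≈y∙xz (1ℚ - y) T _ ⟩
    T * ((1ℚ - y) * negBinomial y (suc m) M)   ≤⟨ *-monoˡ-≤-nonNeg T {{nonNegative (powℚ-nonNeg m 0≤1-y)}} drop-last ⟩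
    T * negBinomial y m M                      ≤⟨ negBinomial-bound m M 0≤y y≤1 ⟩
    1ℚ                                         ∎
    where
    open ≤-Reasoning
    T : ℚ
    T = powℚ (1ℚ - y) m
    0≤1-y : 0ℚ ≤ 1ℚ - y
    0≤1-y = p≤q⇒0≤q-p y≤1
    drop-last : (1ℚ - y) * negBinomial y (suc m) M ≤ negBinomial y m M
    drop-last = subst ((1ℚ - y) * negBinomial y (suc m) M ≤_) (negBinomial-telescope y m M)
      (p≤p+q ((1ℚ - y) * negBinomial y (suc m) M) (*-nonNeg (frac-nonNeg (multichoose (suc m) M) 1) (powℚ-nonNeg (suc M) 0≤y)))

  -- termwise, (m y)^j / j! ≤ multichoose m j · y^j
  expPartial≤negBinomial : ∀ {y} m M → 0ℚ ≤ y → expPartial (fromℕ m * y) M ≤ negBinomial y m M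
  expPartial≤negBinomial     m zero    _   = ≤-refl
  expPartial≤negBinomial {y} m (suc M) 0≤y = +-mono-≤ (expPartial≤negBinomial m M 0≤y) (begin
    powℚ (fromℕ m * y) j * frac 1 (j !)        ≡⟨ cong (_* frac 1 (j !)) (trans (powℚ-*-distrib (fromℕ m) y j)
                                                                               (cong (_* Y) (powℚ-fromℕ m j))) ⟩
    fromℕ (m ℕ.^ j) * Y * frac 1 (j !)         ≡⟨ xy∙z≈xz∙y (fromℕ (m ℕ.^ j)) Y (frac 1 (j !)) ⟩
    fromℕ (m ℕ.^ j) * frac 1 (j !) * Y         ≡⟨ cong (_* Y) (fromℕ-*-frac (m ℕ.^ j) 1 (j !) (ℕ.1≤n! j)) ⟩
    frac (m ℕ.^ j ℕ.* 1) (j !) * Y             ≤⟨ *-monoʳ-≤-nonNeg Y {{nonNegative (powℚ-nonNeg j 0≤y)}}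
                                                    (frac≤fromℕ _ (multichoose m j) (j !) (ℕ.1≤n! j) coefficient≤) ⟩
    fromℕ (multichoose m j) * Y                ∎)
    where
    open ≤-Reasoning
    j : ℕ
    j = suc M
    Y : ℚ
    Y = powℚ y j
    coefficient≤ : m ℕ.^ j ℕ.* 1 ℕ.≤ multichoose m j ℕ.* j !
    coefficient≤ = subst (ℕ._≤ multichoose m j ℕ.* j !) (sym (ℕ.*-identityʳ _)) (m^j≤multichoose*j! m j)

  truncatedExp-bound : ∀ {y} m M → 0ℚ ≤ y → y ≤ 1ℚ → powℚ (1ℚ - y) m * expPartial (fromℕ m * y) M ≤ 1ℚ
  truncatedExp-bound {y} m M 0≤y y≤1 = ≤-trans
    (*-monoˡ-≤-nonNeg (powℚ (1ℚ - y) m) {{nonNegative (powℚ-nonNeg m (p≤q⇒0≤q-p y≤1))}} (expPartial≤negBinomial m M 0≤y))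
    (negBinomial-bound m M 0≤y y≤1)

  *-expPartial≤1 : ∀ {p x y} m M → 0ℚ ≤ y → y ≤ 1ℚ → p ≤ powℚ (1ℚ - y) m →
                   0ℚ ≤ x → x ≤ fromℕ m * y → p * expPartial x M ≤ 1ℚ
  *-expPartial≤1 {p} {x} {y} m M 0≤y y≤1 p≤[1-y]^m 0≤x x≤my = begin
    p * expPartial x M
      ≤⟨ *-monoʳ-≤-nonNeg (expPartial x M) {{nonNegative (expPartial-nonNeg M 0≤x)}} p≤[1-y]^m ⟩
    powℚ (1ℚ - y) m * expPartial x M
      ≤⟨ *-monoˡ-≤-nonNeg (powℚ (1ℚ - y) m) {{nonNegative (powℚ-nonNeg m (p≤q⇒0≤q-p y≤1))}} (expPartial-mono M 0≤x x≤my) ⟩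
    powℚ (1ℚ - y) m * expPartial (fromℕ m * y) M
      ≤⟨ truncatedExp-bound m M 0≤y y≤1 ⟩
    1ℚ ∎
    where open ≤-Reasoning

  frac-complement : ∀ {c d} → 0 ℕ.< d → c ℕ.≤ d → frac (d ℕ.∸ c) d ≡ 1ℚ - frac c d
  frac-complement {c} {d} 0<d c≤d = begin
    frac (d ℕ.∸ c) d                          ≡⟨ solve 2 (λ a b → a := (a :+ b) :- b) refl (frac (d ℕ.∸ c) d) (frac c d) ⟩
    (frac (d ℕ.∸ c) d + frac c d) - frac c d  ≡⟨ cong (_- frac c d) sum≡1 ⟩
    1ℚ - frac c d                             ∎
    where
    open ≡-Reasoning
    sum≡1 : frac (d ℕ.∸ c) d + frac c d ≡ 1ℚ
    sum≡1 = trans (frac-+ (d ℕ.∸ c) c d d 0<d 0<d) (frac-cong _ 1 (d ℕ.* d) 1 (ℕ.*-mono-≤ 0<d 0<d) (s≤s z≤n) (begin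
      ((d ℕ.∸ c) ℕ.* d ℕ.+ c ℕ.* d) ℕ.* 1 ≡⟨ ℕ.*-identityʳ _ ⟩
      (d ℕ.∸ c) ℕ.* d ℕ.+ c ℕ.* d         ≡⟨ sym (ℕ.*-distribʳ-+ d (d ℕ.∸ c) c) ⟩
      (d ℕ.∸ c ℕ.+ c) ℕ.* d               ≡⟨ cong (ℕ._* d) (ℕ.m∸n+n≡m c≤d) ⟩
      d ℕ.* d                             ≡⟨ sym (ℕ.*-identityˡ (d ℕ.* d)) ⟩
      1 ℕ.* (d ℕ.* d)                     ∎))

  -- the integer form of the final estimate, with y = c / d
  frac-*-expPartial≤1 : ∀ {a b k l c d} m M → 0 ℕ.< b → 0 ℕ.< l → 0 ℕ.< d → c ℕ.≤ d →
    a ℕ.* d ℕ.^ m ℕ.≤ (d ℕ.∸ c) ℕ.^ m ℕ.* b → k ℕ.* d ℕ.≤ m ℕ.* c ℕ.* l → frac a b * expPartial (frac k l) M ≤ 1ℚ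
  frac-*-expPartial≤1 {a} {b} {k} {l} {c} {d} m M 0<b 0<l 0<d c≤d a/b≤ k/l≤ =
    *-expPartial≤1 m M (frac-nonNeg c d) y≤1 p≤ (frac-nonNeg k l) x≤
    where
    y≤1 : frac c d ≤ 1ℚ
    y≤1 = frac≤fromℕ c 1 d 0<d (subst (c ℕ.≤_) (sym (ℕ.*-identityˡ d)) c≤d)
    p≤ : frac a b ≤ powℚ (1ℚ - frac c d) m
    p≤ = subst (frac a b ≤_) (trans (sym (powℚ-frac (d ℕ.∸ c) d m 0<d)) (cong (λ t → powℚ t m) (frac-complement 0<d c≤d)))
           (frac-mono a _ b (d ℕ.^ m) 0<b (ℕ.m^n>0 d {{ℕ.>-nonZero 0<d}} m) a/b≤)
    x≤ : frac k l ≤ fromℕ m * frac c d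
    x≤ = subst (frac k l ≤_) (sym (fromℕ-*-frac m c d 0<d)) (frac-mono k (m ℕ.* c) l d 0<l 0<d k/l≤)

module FilterLengths where

  open import Data.Bool.Base using (Bool; true; false; not; _∧_; _∨_)
  open import Data.List.Base using (List; []; _∷_; length; filterᵇ; map)
  open import Data.Nat.Base using (suc; _+_; _≤_; z≤n; s≤s)
  open import Data.Nat.Properties using (≤-refl; ≤-trans; ≤-reflexive; n≤1+n; +-suc; +-monoʳ-≤)
  open import Function.Base using (_∘_)
  open import Relation.Binary.PropositionalEquality

  private variable
    A B : Set

  filterᵇ-filterᵇ : ∀ (f g : A → Bool) xs → filterᵇ g (filterᵇ f xs) ≡ filterᵇ (λ x → f x ∧ g x) xs
  filterᵇ-filterᵇ f g []       = refl
  filterᵇ-filterᵇ f g (x ∷ xs) with f x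
  ... | false = filterᵇ-filterᵇ f g xs
  ... | true with g x
  ...   | true  = cong (x ∷_) (filterᵇ-filterᵇ f g xs)
  ...   | false = filterᵇ-filterᵇ f g xs

  filterᵇ-cong : ∀ {f g : A → Bool} → (∀ x → f x ≡ g x) → ∀ xs → filterᵇ f xs ≡ filterᵇ g xs
  filterᵇ-cong         f≗g []       = refl
  filterᵇ-cong {g = g} f≗g (x ∷ xs) rewrite f≗g x with g x
  ... | true  = cong (x ∷_) (filterᵇ-cong f≗g xs)
  ... | false = filterᵇ-cong f≗g xs

  filterᵇ-true : ∀ (xs : List A) → filterᵇ (λ _ → true) xs ≡ xs
  filterᵇ-true []       = refl
  filterᵇ-true (x ∷ xs) = cong (x ∷_) (filterᵇ-true xs)

  filterᵇ-false : ∀ (xs : List A) → filterᵇ (λ _ → false) xs ≡ []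
  filterᵇ-false []       = refl
  filterᵇ-false (x ∷ xs) = filterᵇ-false xs

  length-filterᵇ-map : ∀ (f : B → Bool) (g : A → B) xs → length (filterᵇ f (map g xs)) ≡ length (filterᵇ (f ∘ g) xs)
  length-filterᵇ-map f g []       = refl
  length-filterᵇ-map f g (x ∷ xs) with f (g x)
  ... | true  = cong suc (length-filterᵇ-map f g xs)
  ... | false = length-filterᵇ-map f g xs

  private
    cover-step : ∀ (f g : A → Bool) xs {Y} →
      length xs ≤ length (filterᵇ (λ x → not (f x ∨ g x)) xs) + (length (filterᵇ f xs) + length (filterᵇ g xs)) →
      suc (length (filterᵇ f xs) + length (filterᵇ g xs)) ≤ Y →
      suc (length xs) ≤ length (filterᵇ (λ x → not (f x ∨ g x)) xs) + Y
    cover-step f g xs ih covered =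
      ≤-trans (s≤s ih) (≤-trans (≤-reflexive (sym (+-suc _ _))) (+-monoʳ-≤ _ covered))

  length-≤-filterᵇ-cover : ∀ (f g : A → Bool) xs →
    length xs ≤ length (filterᵇ (λ x → not (f x ∨ g x)) xs) + (length (filterᵇ f xs) + length (filterᵇ g xs))
  length-≤-filterᵇ-cover f g []       = z≤n
  length-≤-filterᵇ-cover f g (x ∷ xs) with f x | g x
  ... | false | false = s≤s (length-≤-filterᵇ-cover f g xs)
  ... | true  | false = cover-step f g xs (length-≤-filterᵇ-cover f g xs) ≤-refl
  ... | false | true  = cover-step f g xs (length-≤-filterᵇ-cover f g xs) (≤-reflexive (sym (+-suc _ _)))
  ... | true  | true  = cover-step f g xs (length-≤-filterᵇ-cover f g xs) (s≤s (+-monoʳ-≤ _ (n≤1+n _)))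


module SubsetCounting where

  open import Data.Bool.Base using (Bool; true; false; not; _∧_; if_then_else_)
  import Data.Bool.Properties as Bool
  open import Data.Empty using (⊥-elim)
  open import Data.Fin.Base as Fin using (Fin; punchIn; punchOut)
  open import Data.Fin.Properties using (punchIn-punchOut)
  open import Data.Fin.Subset using (Subset; inside; outside; ∣_∣)
  open import Data.List.Base using (List; _++_; length; map; filterᵇ)
  open import Data.List.Properties using (filter-++; length-++)
  open import Data.Nat.Base using (ℕ; zero; suc; _+_; _*_; _∸_; _≤_; _<_; z≤n; s≤s)
  open import Data.Nat.Properties
  open import Data.Nat.Tactic.RingSolver using (solve-∀)
  import Algebra.Properties.CommutativeSemigroup as CommSemigroupProperties
  open CommSemigroupProperties +-commutativeSemigroup using ()
    renaming (interchange to +-interchange; x∙yz≈y∙xz to +-x∙yz≈y∙xz)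
  open CommSemigroupProperties *-commutativeSemigroup using ()
    renaming (xy∙z≈y∙xz to *-xy∙z≈y∙xz; x∙yz≈y∙xz to *-x∙yz≈y∙xz)
  open import Data.Vec.Base using (Vec; []; _∷_; lookup; insertAt; _[_]≔_)
  open import Data.Vec.Properties using (insertAt-lookup; insertAt-punchIn)
  open import Function.Base using (_∘_)
  open import Relation.Binary.PropositionalEquality
  open import Relation.Nullary.Decidable using (⌊_⌋; T?; yes; no; dec-false)
  open FilterLengths

  count : ∀ {n} → ℕ → (Subset n → Bool) → ℕ
  count {zero}  zero    φ = if φ [] then 1 else 0
  count {zero}  (suc r) φ = 0
  count {suc n} zero    φ = count zero (φ ∘ (outside ∷_))
  count {suc n} (suc r) φ = count r (φ ∘ (inside ∷_)) + count (suc r) (φ ∘ (outside ∷_))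

  _⇒ᵇ_ : ∀ {n} → (Subset n → Bool) → (Subset n → Bool) → Set
  φ ⇒ᵇ ψ = ∀ s → φ s ≡ true → ψ s ≡ true

  count-cong : ∀ {n} {φ ψ : Subset n → Bool} → (∀ s → φ s ≡ ψ s) → ∀ r → count r φ ≡ count r ψ
  count-cong {zero}  φ≗ψ zero    = cong (λ b → if b then 1 else 0) (φ≗ψ [])
  count-cong {zero}  φ≗ψ (suc r) = refl
  count-cong {suc n} φ≗ψ zero    = count-cong (φ≗ψ ∘ (outside ∷_)) zero
  count-cong {suc n} φ≗ψ (suc r) =
    cong₂ _+_ (count-cong (φ≗ψ ∘ (inside ∷_)) r) (count-cong (φ≗ψ ∘ (outside ∷_)) (suc r))

  count-mono : ∀ {n} {φ ψ : Subset n → Bool} → φ ⇒ᵇ ψ → ∀ r → count r φ ≤ count r ψ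
  count-mono {zero} {φ} φ⇒ψ zero with φ [] in φ[]
  ... | true  rewrite φ⇒ψ [] φ[] = ≤-refl
  ... | false = z≤n
  count-mono {zero}  φ⇒ψ (suc r) = z≤n
  count-mono {suc n} φ⇒ψ zero    = count-mono (φ⇒ψ ∘ (outside ∷_)) zero
  count-mono {suc n} φ⇒ψ (suc r) =
    +-mono-≤ (count-mono (φ⇒ψ ∘ (inside ∷_)) r) (count-mono (φ⇒ψ ∘ (outside ∷_)) (suc r))

  count-none : ∀ {n} {φ : Subset n → Bool} → (∀ s → φ s ≡ false) → ∀ r → count r φ ≡ 0
  count-none {zero}  φ≡false zero    rewrite φ≡false [] = refl
  count-none {zero}  φ≡false (suc r) = refl
  count-none {suc n} φ≡false zero    = count-none (φ≡false ∘ (outside ∷_)) zero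
  count-none {suc n} φ≡false (suc r) =
    cong₂ _+_ (count-none (φ≡false ∘ (inside ∷_)) r) (count-none (φ≡false ∘ (outside ∷_)) (suc r))

  count-split : ∀ {n} (φ ψ : Subset n → Bool) r →
                count r φ ≡ count r (λ s → φ s ∧ ψ s) + count r (λ s → φ s ∧ not (ψ s))
  count-split {zero} φ ψ zero with φ [] | ψ []
  ... | true  | true  = refl
  ... | true  | false = refl
  ... | false | _     = refl
  count-split {zero}  φ ψ (suc r) = refl
  count-split {suc n} φ ψ zero    = count-split (φ ∘ (outside ∷_)) (ψ ∘ (outside ∷_)) zero
  count-split {suc n} φ ψ (suc r) = trans
    (cong₂ _+_ (count-split (φ ∘ (inside ∷_)) (ψ ∘ (inside ∷_)) r)
               (count-split (φ ∘ (outside ∷_)) (ψ ∘ (outside ∷_)) (suc r)))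
    (+-interchange (count r (λ s → φ (inside ∷ s) ∧ ψ (inside ∷ s))) _ _ _)

  count-insertAt₀ : ∀ {n} (φ : Subset (suc n) → Bool) a →
                    count zero φ ≡ count zero (λ s → φ (insertAt s a outside))
  count-insertAt₀ {n}     φ Fin.zero    = refl
  count-insertAt₀ {suc n} φ (Fin.suc a) = count-insertAt₀ (φ ∘ (outside ∷_)) a

  count-insertAt : ∀ {n} (φ : Subset (suc n) → Bool) a r →
                   count (suc r) φ ≡ count r (λ s → φ (insertAt s a inside)) + count (suc r) (λ s → φ (insertAt s a outside))
  count-insertAt {n}     φ Fin.zero    r       = refl
  count-insertAt {suc n} φ (Fin.suc a) zero    = trans
    (cong₂ _+_ (count-insertAt₀ (φ ∘ (inside ∷_)) a) (count-insertAt (φ ∘ (outside ∷_)) a zero))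
    (+-x∙yz≈y∙xz (count zero (λ s → φ (inside ∷ insertAt s a outside)))
               (count zero (λ s → φ (outside ∷ insertAt s a inside)))
               (count 1 (λ s → φ (outside ∷ insertAt s a outside))))
  count-insertAt {suc n} φ (Fin.suc a) (suc r) = trans
    (cong₂ _+_ (count-insertAt (φ ∘ (inside ∷_)) a r) (count-insertAt (φ ∘ (outside ∷_)) a (suc r)))
    (+-interchange (count r (λ s → φ (inside ∷ insertAt s a inside))) _ _ _)

  count-∋ : ∀ {n} (φ : Subset (suc n) → Bool) a k →
            count (suc k) (λ s → φ s ∧ lookup s a) ≡ count k (λ s → φ (insertAt s a inside))
  count-∋ φ a k = begin
    count (suc k) (λ s → φ s ∧ lookup s a)
      ≡⟨ count-insertAt (λ s → φ s ∧ lookup s a) a k ⟩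
    count k (λ s → φ (insertAt s a inside) ∧ lookup (insertAt s a inside) a)
      + count (suc k) (λ s → φ (insertAt s a outside) ∧ lookup (insertAt s a outside) a)
      ≡⟨ cong₂ _+_
           (count-cong (λ s → trans (cong (φ (insertAt s a inside) ∧_) (insertAt-lookup s a inside)) (Bool.∧-identityʳ _)) k)
           (count-none (λ s → trans (cong (φ (insertAt s a outside) ∧_) (insertAt-lookup s a outside)) (Bool.∧-zeroʳ _)) (suc k)) ⟩
    count k (λ s → φ (insertAt s a inside)) + 0
      ≡⟨ +-identityʳ _ ⟩
    count k (λ s → φ (insertAt s a inside)) ∎
    where open ≡-Reasoning

  private
    ⌊suc≟suc⌋ : ∀ m n → ⌊ suc m ≟ suc n ⌋ ≡ ⌊ m ≟ n ⌋
    ⌊suc≟suc⌋ m n with m ≟ n | suc m ≟ suc n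
    ... | yes _   | yes _       = refl
    ... | no  _   | no  _       = refl
    ... | yes m≡n | no  1+m≢1+n = ⊥-elim (1+m≢1+n (cong suc m≡n))
    ... | no  m≢n | yes 1+m≡1+n = ⊥-elim (m≢n (suc-injective 1+m≡1+n))

  length-filterᵇ-allSubsets : ∀ n r (φ : Subset n → Bool) →
    length (filterᵇ (λ s → ⌊ ∣ s ∣ ≟ r ⌋ ∧ φ s) (allSubsets n)) ≡ count r φ
  length-filterᵇ-allSubsets zero zero φ with φ []
  ... | true  = refl
  ... | false = refl
  length-filterᵇ-allSubsets zero    (suc r) φ = refl
  length-filterᵇ-allSubsets (suc n) r       φ = begin
    length (filterᵇ h (map (inside ∷_) A ++ map (outside ∷_) A))
      ≡⟨ cong length (filter-++ (T? ∘ h) (map (inside ∷_) A) _) ⟩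
    length (filterᵇ h (map (inside ∷_) A) ++ filterᵇ h (map (outside ∷_) A))
      ≡⟨ length-++ (filterᵇ h (map (inside ∷_) A)) ⟩
    length (filterᵇ h (map (inside ∷_) A)) + length (filterᵇ h (map (outside ∷_) A))
      ≡⟨ cong₂ _+_ (length-filterᵇ-map h (inside ∷_) A) (length-filterᵇ-map h (outside ∷_) A) ⟩
    length (filterᵇ (h ∘ (inside ∷_)) A) + length (filterᵇ (h ∘ (outside ∷_)) A)
      ≡⟨ split r ⟩
    count r φ ∎
    where
    open ≡-Reasoning
    A : List (Subset n)
    A = allSubsets n
    h : Subset (suc n) → Bool
    h s = ⌊ ∣ s ∣ ≟ r ⌋ ∧ φ s
    split : ∀ r → length (filterᵇ (λ s → ⌊ ∣ inside ∷ s ∣ ≟ r ⌋ ∧ φ (inside ∷ s)) A)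
                  + length (filterᵇ (λ s → ⌊ ∣ outside ∷ s ∣ ≟ r ⌋ ∧ φ (outside ∷ s)) A) ≡ count r φ
    split zero    = cong₂ _+_
      (cong length (trans (filterᵇ-cong (λ s → cong (_∧ φ (inside ∷ s)) (dec-false (suc ∣ s ∣ ≟ 0) λ ())) A) (filterᵇ-false A)))
      (length-filterᵇ-allSubsets n zero (φ ∘ (outside ∷_)))
    split (suc r) = cong₂ _+_
      (trans (cong length (filterᵇ-cong (λ s → cong (_∧ φ (inside ∷ s)) (⌊suc≟suc⌋ ∣ s ∣ r)) A))
             (length-filterᵇ-allSubsets n r (φ ∘ (inside ∷_))))
      (length-filterᵇ-allSubsets n (suc r) (φ ∘ (outside ∷_)))

  length-filterᵇ-rSubsets : ∀ n r (φ : Subset n → Bool) → length (filterᵇ φ (rSubsets n r)) ≡ count r φ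
  length-filterᵇ-rSubsets n r φ =
    trans (cong length (filterᵇ-filterᵇ _ φ (allSubsets n))) (length-filterᵇ-allSubsets n r φ)

  length-rSubsets : ∀ n r → length (rSubsets n r) ≡ count {n} r (λ _ → true)
  length-rSubsets n r = trans (cong length (sym (filterᵇ-true (rSubsets n r)))) (length-filterᵇ-rSubsets n r _)

  count-true>0 : ∀ {n} r → r ≤ n → 0 < count {n} r (λ _ → true)
  count-true>0 {zero}  zero    _         = s≤s z≤n
  count-true>0 {suc n} zero    _         = count-true>0 {n} zero z≤n
  count-true>0 {suc n} (suc r) (s≤s r≤n) = ≤-trans (count-true>0 r r≤n) (m≤m+n _ _)

  DownClosed : ∀ {n} → (Subset n → Bool) → Set
  DownClosed {n} φ = ∀ s (i : Fin n) → φ s ≡ true → φ (s [ i ]≔ outside) ≡ true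

  Ignores : ∀ {n} → (Subset n → Bool) → Fin n → Set
  Ignores φ i = ∀ s v → φ (s [ i ]≔ v) ≡ φ s

  insertAt-[]≔ : ∀ {A : Set} {n} (xs : Vec A n) a i (v w : A) →
                 insertAt (xs [ i ]≔ w) a v ≡ insertAt xs a v [ punchIn a i ]≔ w
  insertAt-[]≔ xs       Fin.zero    i           v w = refl
  insertAt-[]≔ (x ∷ xs) (Fin.suc a) Fin.zero    v w = refl
  insertAt-[]≔ (x ∷ xs) (Fin.suc a) (Fin.suc i) v w = cong (x ∷_) (insertAt-[]≔ xs a i v w)

  []≔-insertAt : ∀ {A : Set} {n} (xs : Vec A n) a (v w : A) → insertAt xs a w [ a ]≔ v ≡ insertAt xs a v
  []≔-insertAt xs       Fin.zero    v w = refl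
  []≔-insertAt (x ∷ xs) (Fin.suc a) v w = cong (x ∷_) ([]≔-insertAt xs a v w)

  DownClosed-∷ : ∀ {n} {φ : Subset (suc n) → Bool} v → DownClosed φ → DownClosed (φ ∘ (v ∷_))
  DownClosed-∷ v φ↓ s i = φ↓ (v ∷ s) (Fin.suc i)

  DownClosed-insertAt : ∀ {n} {φ : Subset (suc n) → Bool} a v → DownClosed φ → DownClosed (λ s → φ (insertAt s a v))
  DownClosed-insertAt {φ = φ} a v φ↓ s i φs =
    subst (λ t → φ t ≡ true) (sym (insertAt-[]≔ s a i v outside)) (φ↓ (insertAt s a v) (punchIn a i) φs)

  DownClosed-head : ∀ {n} {φ : Subset (suc n) → Bool} → DownClosed φ → (φ ∘ (inside ∷_)) ⇒ᵇ (φ ∘ (outside ∷_))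
  DownClosed-head φ↓ s = φ↓ (inside ∷ s) Fin.zero

  Ignores-insertAt : ∀ {n} {φ : Subset (suc n) → Bool} a → Ignores φ a → ∀ s → φ (insertAt s a inside) ≡ φ (insertAt s a outside)
  Ignores-insertAt {φ = φ} a φ⊥a s = trans (cong φ (sym ([]≔-insertAt s a inside outside))) (φ⊥a (insertAt s a outside) inside)

  -- (k + 1)·a_{k+1} ≤ (n − k)·a_k, with k·a_k moved left, for the layer sizes a_k = count k φ of a down-closed family
  local-LYM : ∀ {n} {φ : Subset n → Bool} → DownClosed φ → ∀ k →
              suc k * count (suc k) φ + k * count k φ ≤ n * count k φ
  local-LYM {zero}  φ↓ zero    = z≤n
  local-LYM {zero}  φ↓ (suc k) = ≤-reflexive (cong₂ _+_ (*-zeroʳ (2 + k)) (*-zeroʳ (suc k)))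
  local-LYM {suc n} {φ} φ↓ zero = begin
    1 * (B₀ + A₁) + 0             ≡⟨ regroup B₀ A₁ A₀ ⟩
    B₀ + (1 * A₁ + 0 * A₀)        ≤⟨ +-mono-≤ (count-mono (DownClosed-head φ↓) 0) (local-LYM (DownClosed-∷ outside φ↓) 0) ⟩
    A₀ + n * A₀                   ∎
    where
    open ≤-Reasoning
    A₀ A₁ B₀ : ℕ
    A₀ = count 0 (φ ∘ (outside ∷_))
    A₁ = count 1 (φ ∘ (outside ∷_))
    B₀ = count 0 (φ ∘ (inside ∷_))
    regroup : ∀ b a₁ a₀ → 1 * (b + a₁) + 0 ≡ b + (1 * a₁ + 0 * a₀)
    regroup = solve-∀
  local-LYM {suc n} {φ} φ↓ (suc k) = begin
    (2 + k) * (B (suc k) + A (2 + k)) + suc k * (B k + A (suc k))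
      ≡⟨ regroup k (A (2 + k)) (A (suc k)) (B (suc k)) (B k) ⟩
    ((2 + k) * A (2 + k) + suc k * A (suc k)) + (suc k * B (suc k) + k * B k) + (B (suc k) + B k)
      ≤⟨ +-mono-≤ (+-mono-≤ (local-LYM (DownClosed-∷ outside φ↓) (suc k)) (local-LYM (DownClosed-∷ inside φ↓) k))
                  (+-monoˡ-≤ (B k) (count-mono (DownClosed-head φ↓) (suc k))) ⟩
    n * A (suc k) + n * B k + (A (suc k) + B k)
      ≡⟨ collect n (A (suc k)) (B k) ⟩
    suc n * (B k + A (suc k)) ∎
    where
    open ≤-Reasoning
    A B : ℕ → ℕ
    A j = count j (φ ∘ (outside ∷_))
    B j = count j (φ ∘ (inside ∷_))
    regroup : ∀ k a₂ a₁ b₁ b₀ → (2 + k) * (b₁ + a₂) + suc k * (b₀ + a₁)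
                              ≡ ((2 + k) * a₂ + suc k * a₁) + (suc k * b₁ + k * b₀) + (b₁ + b₀)
    regroup = solve-∀
    collect : ∀ n a b → n * a + n * b + (a + b) ≡ suc n * (b + a)
    collect = solve-∀

  member-proportion : ∀ {n} {ψ : Subset (suc n) → Bool} a → DownClosed ψ → Ignores ψ a → ∀ k →
                      k * count k ψ ≤ suc n * count k (λ s → ψ s ∧ lookup s a)
  member-proportion a ψ↓ ψ⊥a zero = z≤n
  member-proportion {n} {ψ} a ψ↓ ψ⊥a (suc k) = begin
    suc k * count (suc k) ψ               ≡⟨ cong (suc k *_) (count-insertAt ψ a k) ⟩
    suc k * (Y k + X (suc k))             ≡⟨ cong (λ c → suc k * (c + X (suc k))) Y≡X ⟩
    suc k * (X k + X (suc k))             ≡⟨ regroup k (X k) (X (suc k)) ⟩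
    X k + (suc k * X (suc k) + k * X k)   ≤⟨ +-monoʳ-≤ (X k) (local-LYM (DownClosed-insertAt a outside ψ↓) k) ⟩
    suc n * X k                           ≡⟨ cong (suc n *_) (sym Y≡X) ⟩
    suc n * Y k                           ≡⟨ cong (suc n *_) (sym (count-∋ ψ a k)) ⟩
    suc n * count (suc k) (λ s → ψ s ∧ lookup s a) ∎
    where
    open ≤-Reasoning
    X Y : ℕ → ℕ
    X j = count j (λ s → ψ (insertAt s a outside))
    Y j = count j (λ s → ψ (insertAt s a inside))
    Y≡X : Y k ≡ X k
    Y≡X = count-cong (Ignores-insertAt a ψ⊥a) k
    regroup : ∀ k x₀ x₁ → suc k * (x₀ + x₁) ≡ x₀ + (suc k * x₁ + k * x₀)
    regroup = solve-∀

  Ignores-insertAt-punchIn : ∀ {n} {φ : Subset (suc n) → Bool} a i v →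
                             Ignores φ (punchIn a i) → Ignores (λ s → φ (insertAt s a v)) i
  Ignores-insertAt-punchIn {φ = φ} a i v φ⊥i s w = trans (cong φ (insertAt-[]≔ s a i v w)) (φ⊥i (insertAt s a v) w)

  count-∋-punchIn : ∀ {n} (φ : Subset (suc n) → Bool) a b k →
    count (suc k) (λ s → φ s ∧ (lookup s a ∧ lookup s (punchIn a b))) ≡ count k (λ s → φ (insertAt s a inside) ∧ lookup s b)
  count-∋-punchIn φ a b k = begin
    count (suc k) (λ s → φ s ∧ (lookup s a ∧ lookup s (punchIn a b)))
      ≡⟨ count-cong (λ s → ∧-swap (φ s) (lookup s a) (lookup s (punchIn a b))) (suc k) ⟩
    count (suc k) (λ s → (φ s ∧ lookup s (punchIn a b)) ∧ lookup s a)
      ≡⟨ count-∋ (λ s → φ s ∧ lookup s (punchIn a b)) a k ⟩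
    count k (λ s → φ (insertAt s a inside) ∧ lookup (insertAt s a inside) (punchIn a b))
      ≡⟨ count-cong (λ s → cong (φ (insertAt s a inside) ∧_) (insertAt-punchIn s a inside b)) k ⟩
    count k (λ s → φ (insertAt s a inside) ∧ lookup s b) ∎
    where
    open ≡-Reasoning
    ∧-swap : ∀ x y z → x ∧ (y ∧ z) ≡ (x ∧ z) ∧ y
    ∧-swap x y z = trans (cong (x ∧_) (Bool.∧-comm y z)) (sym (Bool.∧-assoc x z y))

  pair-proportion : ∀ {n} {φ : Subset n → Bool} {a b} → a ≢ b → DownClosed φ → Ignores φ a → Ignores φ b → ∀ r →
                    r * (r ∸ 1) * count r φ ≤ n * (n ∸ 1) * count r (λ s → φ s ∧ (lookup s a ∧ lookup s b))
  pair-proportion {suc zero}    {a = Fin.zero} {Fin.zero} a≢b = ⊥-elim (a≢b refl)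
  pair-proportion {suc (suc n)} {φ} {a} {b} a≢b φ↓ φ⊥a φ⊥b r =
    subst (λ b → r * (r ∸ 1) * count r φ ≤ (2 + n) * suc n * count r (λ s → φ s ∧ (lookup s a ∧ lookup s b)))
      (punchIn-punchOut a≢b)
      (punchIn-proportion (punchOut a≢b) (subst (Ignores φ) (sym (punchIn-punchOut a≢b)) φ⊥b) r)
    where
    punchIn-proportion : ∀ b → Ignores φ (punchIn a b) → ∀ r →
      r * (r ∸ 1) * count r φ ≤ (2 + n) * suc n * count r (λ s → φ s ∧ (lookup s a ∧ lookup s (punchIn a b)))
    punchIn-proportion b φ⊥b zero    = z≤n
    punchIn-proportion b φ⊥b (suc r) = begin
      suc r * r * count (suc r) φ                            ≡⟨ *-xy∙z≈y∙xz (suc r) r (count (suc r) φ) ⟩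
      r * (suc r * count (suc r) φ)                          ≤⟨ *-monoʳ-≤ r (member-proportion a φ↓ φ⊥a (suc r)) ⟩
      r * ((2 + n) * count (suc r) (λ s → φ s ∧ lookup s a)) ≡⟨ cong (λ c → r * ((2 + n) * c)) (count-∋ φ a r) ⟩
      r * ((2 + n) * count r χ)                              ≡⟨ *-x∙yz≈y∙xz r (2 + n) (count r χ) ⟩
      (2 + n) * (r * count r χ)                              ≤⟨ *-monoʳ-≤ (2 + n) (member-proportion b χ↓ χ⊥b r) ⟩
      (2 + n) * (suc n * count r (λ s → χ s ∧ lookup s b))   ≡⟨ sym (*-assoc (2 + n) (suc n) _) ⟩
      (2 + n) * suc n * count r (λ s → χ s ∧ lookup s b)     ≡⟨ cong ((2 + n) * suc n *_) (sym (count-∋-punchIn φ a b r)) ⟩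
      (2 + n) * suc n * count (suc r) (λ s → φ s ∧ (lookup s a ∧ lookup s (punchIn a b))) ∎
      where
      open ≤-Reasoning
      χ : Subset (suc n) → Bool
      χ s = φ (insertAt s a inside)
      χ↓ : DownClosed χ
      χ↓ = DownClosed-insertAt a inside φ↓
      χ⊥b : Ignores χ b
      χ⊥b = Ignores-insertAt-punchIn a b inside φ⊥b

  avoid-pair-proportion : ∀ {n} {φ : Subset n → Bool} {a b} → a ≢ b → DownClosed φ → Ignores φ a → Ignores φ b → ∀ r →
    count r (λ s → not (lookup s a ∧ lookup s b) ∧ φ s) * (n * (n ∸ 1)) + count r φ * (r * (r ∸ 1)) ≤ count r φ * (n * (n ∸ 1))
  avoid-pair-proportion {n} {φ} {a} {b} a≢b φ↓ φ⊥a φ⊥b r = begin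
    count r (λ s → not (ab s) ∧ φ s) * D + T * c ≡⟨ cong (λ x → x * D + T * c) (count-cong (λ s → Bool.∧-comm (not (ab s)) (φ s)) r) ⟩
    X * D + T * c                                ≤⟨ +-monoʳ-≤ (X * D) (subst₂ _≤_ (*-comm c T) (*-comm D Y) (pair-proportion a≢b φ↓ φ⊥a φ⊥b r)) ⟩
    X * D + Y * D                                ≡⟨ sym (*-distribʳ-+ D X Y) ⟩
    (X + Y) * D                                  ≡⟨ cong (_* D) (trans (+-comm X Y) (sym (count-split φ ab r))) ⟩
    T * D                                        ∎
    where
    open ≤-Reasoning
    ab : Subset n → Bool
    ab s = lookup s a ∧ lookup s b
    D c T X Y : ℕ
    D = n * (n ∸ 1)
    c = r * (r ∸ 1)
    T = count r φ
    X = count r (λ s → φ s ∧ not (ab s))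
    Y = count r (λ s → φ s ∧ ab s)

module Matchings where

  open import Data.Bool.Base using (Bool; true; false; not; _∧_; _∨_; T)
  open import Data.Bool.Properties using (∧-conicalˡ; ∧-conicalʳ)
  open import Data.Fin.Base using (Fin)
  open import Data.Fin.Properties using (_≟_)
  open import Data.Fin.Subset using (Subset; outside)
  open import Data.List.Base using (List; []; _∷_; length; filterᵇ)
  open import Data.List.Properties using (length-filter)
  open import Data.List.Relation.Binary.Sublist.Propositional using (_⊆_; []; _∷_; _∷ʳ_; ⊆-trans)
  open import Data.List.Relation.Binary.Sublist.Propositional.Properties using (filter-⊆; filter⁺; length-mono-≤; All-resp-⊆)
  open import Data.List.Relation.Unary.All as All using (All; []; _∷_)
  open import Data.List.Relation.Unary.All.Properties using (all-filter)
  open import Data.List.Relation.Unary.AllPairs using (AllPairs; []; _∷_)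
  open import Data.Nat.Base using (ℕ; zero; suc; _+_; _*_; _∸_; _^_; _≤_; _<_; z≤n; s≤s)
  open import Data.Nat.Induction using (<-wellFounded)
  open import Data.Nat.Properties hiding (_≟_)
  open import Data.Nat.Tactic.RingSolver using (solve-∀)
  open import Algebra.Properties.CommutativeSemigroup *-commutativeSemigroup using (xy∙z≈xz∙y; xy∙z≈x∙zy)
  open import Data.Product.Base using (_×_; _,_; proj₁; proj₂; ∃-syntax)
  open import Data.Vec.Base using (_∷_; lookup; _[_]≔_)
  open import Data.Vec.Properties using (lookup∘update′)
  open import Function.Base using (_∘_; id)
  open import Induction.WellFounded using (Acc; acc)
  open import Relation.Binary.PropositionalEquality
  open import Relation.Nullary.Decidable using (⌊_⌋; T?; yes; no)
  open import Relation.Nullary.Negation using (contradiction)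
  open SubsetCounting
  open FilterLengths using (length-≤-filterᵇ-cover)

  Pair : ℕ → Set
  Pair n = Fin n × Fin n

  NonLoop : ∀ {n} → Pair n → Set
  NonLoop e = proj₁ e ≢ proj₂ e

  Untouched : ∀ {n} → Fin n → Pair n → Set
  Untouched u p = proj₁ p ≢ u × proj₂ p ≢ u

  Disjoint : ∀ {n} → Pair n → Pair n → Set
  Disjoint e p = Untouched (proj₁ e) p × Untouched (proj₂ e) p

  Matching : ∀ {n} → List (Pair n) → Set
  Matching M = All NonLoop M × AllPairs Disjoint M

  lookup-[]≔-outside : ∀ {n} (s : Subset n) i j → lookup (s [ i ]≔ outside) j ≡ true → lookup s j ≡ true
  lookup-[]≔-outside (x ∷ s) Fin.zero    Fin.zero    ()
  lookup-[]≔-outside (x ∷ s) Fin.zero    (Fin.suc j) = id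
  lookup-[]≔-outside (x ∷ s) (Fin.suc i) Fin.zero    = id
  lookup-[]≔-outside (x ∷ s) (Fin.suc i) (Fin.suc j) = lookup-[]≔-outside s i j

  private
    not-∧-antitone : ∀ {x y x′ y′} → (x ≡ true → x′ ≡ true) → (y ≡ true → y′ ≡ true) →
                     not (x′ ∧ y′) ≡ true → not (x ∧ y) ≡ true
    not-∧-antitone {true}  {true}  x⇒x′ y⇒y′ rewrite x⇒x′ refl | y⇒y′ refl = id
    not-∧-antitone {true}  {false} _    _    _ = refl
    not-∧-antitone {false}         _    _    _ = refl

  avoids-antitone : ∀ {n} (P : List (Pair n)) (s t : Subset n) → (∀ j → lookup s j ≡ true → lookup t j ≡ true) →
                    avoids P t ≡ true → avoids P s ≡ true
  avoids-antitone []      s t s⊆t _        = refl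
  avoids-antitone (p ∷ P) s t s⊆t t-avoids = cong₂ _∧_
    (not-∧-antitone (s⊆t (proj₁ p)) (s⊆t (proj₂ p)) (∧-conicalˡ _ _ t-avoids))
    (avoids-antitone P s t s⊆t (∧-conicalʳ _ _ t-avoids))

  avoids-DownClosed : ∀ {n} (P : List (Pair n)) → DownClosed (avoids P)
  avoids-DownClosed P s i = avoids-antitone P (s [ i ]≔ outside) s (lookup-[]≔-outside s i)

  avoids-Ignores : ∀ {n} (P : List (Pair n)) i → All (Untouched i) P → Ignores (avoids P) i
  avoids-Ignores []      i []                    s v = refl
  avoids-Ignores (p ∷ P) i ((p₁≢i , p₂≢i) ∷ P⊥i) s v = cong₂ _∧_
    (cong not (cong₂ _∧_ (lookup∘update′ p₁≢i s v) (lookup∘update′ p₂≢i s v)))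
    (avoids-Ignores P i P⊥i s v)

  avoids-⊆ : ∀ {n} {M P : List (Pair n)} → M ⊆ P → ∀ s → avoids P s ≡ true → avoids M s ≡ true
  avoids-⊆ []            s _        = refl
  avoids-⊆ (p ∷ʳ M⊆P)    s P-avoids = avoids-⊆ M⊆P s (∧-conicalʳ _ _ P-avoids)
  avoids-⊆ (refl ∷ M⊆P)  s P-avoids = cong₂ _∧_ (∧-conicalˡ _ _ P-avoids) (avoids-⊆ M⊆P s (∧-conicalʳ _ _ P-avoids))

  matching-bound : ∀ {n} r (M : List (Pair n)) → Matching M →
    count r (avoids M) * (n * (n ∸ 1)) ^ length M ≤ count {n} r (λ _ → true) * (n * (n ∸ 1) ∸ r * (r ∸ 1)) ^ length M
  matching-bound r []      _ = ≤-refl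
  matching-bound {n} r (e ∷ M) (e-ok ∷ M-ok , e⊥M ∷ M-disjoint) = begin
    count r (avoids (e ∷ M)) * (D * D ^ m) ≡⟨ sym (*-assoc (count r (avoids (e ∷ M))) D (D ^ m)) ⟩
    count r (avoids (e ∷ M)) * D * D ^ m   ≤⟨ *-monoˡ-≤ (D ^ m) one-pair ⟩
    count r (avoids M) * E * D ^ m         ≡⟨ xy∙z≈xz∙y (count r (avoids M)) E (D ^ m) ⟩
    count r (avoids M) * D ^ m * E         ≤⟨ *-monoˡ-≤ E (matching-bound r M (M-ok , M-disjoint)) ⟩
    count {n} r (λ _ → true) * E ^ m * E   ≡⟨ xy∙z≈x∙zy (count {n} r (λ _ → true)) (E ^ m) E ⟩
    count {n} r (λ _ → true) * (E * E ^ m) ∎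
    where
    open ≤-Reasoning
    D E m : ℕ
    D = n * (n ∸ 1)
    E = D ∸ r * (r ∸ 1)
    m = length M
    one-pair : count r (avoids (e ∷ M)) * D ≤ count r (avoids M) * E
    one-pair = ≤-trans (m+n≤o⇒m≤o∸n _ (avoid-pair-proportion e-ok (avoids-DownClosed M)
                         (avoids-Ignores M (proj₁ e) (All.map proj₁ e⊥M)) (avoids-Ignores M (proj₂ e) (All.map proj₂ e⊥M)) r))
                       (≤-reflexive (sym (*-distribˡ-∸ (count r (avoids M)) D (r * (r ∸ 1)))))

  avoiding-rSubsets-bound : ∀ {n} r {P M : List (Pair n)} → M ⊆ P → Matching M →
    length (filterᵇ (avoids P) (rSubsets n r)) * (n * (n ∸ 1)) ^ length M
      ≤ (n * (n ∸ 1) ∸ r * (r ∸ 1)) ^ length M * length (rSubsets n r)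
  avoiding-rSubsets-bound {n} r {P} {M} M⊆P M-matching = begin
    length (filterᵇ (avoids P) (rSubsets n r)) * D ^ m ≡⟨ cong (_* D ^ m) (length-filterᵇ-rSubsets n r (avoids P)) ⟩
    count r (avoids P) * D ^ m                         ≤⟨ *-monoˡ-≤ (D ^ m) (count-mono (avoids-⊆ M⊆P) r) ⟩
    count r (avoids M) * D ^ m                         ≤⟨ matching-bound r M M-matching ⟩
    count {n} r (λ _ → true) * E ^ m                   ≡⟨ *-comm _ (E ^ m) ⟩
    E ^ m * count {n} r (λ _ → true)                   ≡⟨ cong (E ^ m *_) (sym (length-rSubsets n r)) ⟩
    E ^ m * length (rSubsets n r)                      ∎
    where
    open ≤-Reasoning
    D E m : ℕ
    D = n * (n ∸ 1)
    E = D ∸ r * (r ∸ 1)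
    m = length M

  touches : ∀ {n} → Fin n → Pair n → Bool
  touches u p = ⌊ proj₁ p ≟ u ⌋ ∨ ⌊ proj₂ p ≟ u ⌋

  disjointᵇ : ∀ {n} → Pair n → Pair n → Bool
  disjointᵇ e p = not (touches (proj₁ e) p ∨ touches (proj₂ e) p)

  touches≡false⇒Untouched : ∀ {n} (u : Fin n) p → touches u p ≡ false → Untouched u p
  touches≡false⇒Untouched u p _  with proj₁ p ≟ u | proj₂ p ≟ u
  touches≡false⇒Untouched u p _  | no p₁≢u | no p₂≢u = p₁≢u , p₂≢u
  touches≡false⇒Untouched u p () | yes _   | _
  touches≡false⇒Untouched u p () | no _    | yes _

  disjointᵇ⇒Disjoint : ∀ {n} (e p : Pair n) → T (disjointᵇ e p) → Disjoint e p
  disjointᵇ⇒Disjoint e p _  with touches (proj₁ e) p in t₁ | touches (proj₂ e) p in t₂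
  disjointᵇ⇒Disjoint e p _  | false | false = touches≡false⇒Untouched (proj₁ e) p t₁ , touches≡false⇒Untouched (proj₂ e) p t₂
  disjointᵇ⇒Disjoint e p () | true  | _
  disjointᵇ⇒Disjoint e p () | false | true

  degree-⊆ : ∀ {n} {M P : List (Pair n)} → M ⊆ P → ∀ u → degree M u ≤ degree P u
  degree-⊆ M⊆P u = length-mono-≤ (filter⁺ (T? ∘ touches u) (T? ∘ touches u) (λ { refl t → t }) M⊆P)

  degree-endpoint : ∀ {n} (e : Pair n) P {u} → T (touches u e) → degree (e ∷ P) u ≡ suc (degree P u)
  degree-endpoint e P {u} _ with touches u e
  ... | true = refl

  touches-proj₁ : ∀ {n} (e : Pair n) → T (touches (proj₁ e) e)
  touches-proj₁ e with proj₁ e ≟ proj₁ e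
  ... | yes _     = _
  ... | no  e₁≢e₁ = contradiction refl e₁≢e₁

  touches-proj₂ : ∀ {n} (e : Pair n) → T (touches (proj₂ e) e)
  touches-proj₂ e with proj₁ e ≟ proj₂ e | proj₂ e ≟ proj₂ e
  ... | yes _ | _         = _
  ... | no _  | yes _     = _
  ... | no _  | no e₂≢e₂ = contradiction refl e₂≢e₂

  private
    filterᵇ-⊆ : ∀ {A : Set} (f : A → Bool) xs → filterᵇ f xs ⊆ xs
    filterᵇ-⊆ f = filter-⊆ (T? ∘ f)

    -- |P| = 1 + |rest|, and passing from rest to rest′ drops at most (q − 1) + (q − 1) pairs touching e
    greedy-count : ∀ {l l′ t₁ t₂ q m} → l ≤ l′ + (t₁ + t₂) → l′ ≤ 2 * q * m → suc t₁ ≤ q → suc t₂ ≤ q →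
                   suc l ≤ 2 * q * suc m
    greedy-count {l} {l′} {t₁} {t₂} {q} {m} l≤ l′≤ t₁< t₂< = begin
      suc l                        ≤⟨ s≤s l≤ ⟩
      suc (l′ + (t₁ + t₂))         ≤⟨ n≤1+n _ ⟩
      2 + (l′ + (t₁ + t₂))         ≡⟨ shuffle l′ t₁ t₂ ⟩
      l′ + (suc t₁ + suc t₂)       ≤⟨ +-mono-≤ l′≤ (+-mono-≤ t₁< t₂<) ⟩
      2 * q * m + (q + q)          ≡⟨ collect q m ⟩
      2 * q * suc m                ∎
      where
      open ≤-Reasoning
      shuffle : ∀ a b c → 2 + (a + (b + c)) ≡ a + (suc b + suc c)
      shuffle = solve-∀
      collect : ∀ q m → 2 * q * m + (q + q) ≡ 2 * q * suc m
      collect = solve-∀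

  greedy-matching : ∀ {n q} (P : List (Pair n)) → All NonLoop P → (∀ u → degree P u ≤ q) →
                    ∃[ M ] M ⊆ P × Matching M × length P ≤ 2 * q * length M
  greedy-matching {n} {q} P = go P (<-wellFounded (length P))
    where
    go : ∀ P → Acc _<_ (length P) → All NonLoop P → (∀ u → degree P u ≤ q) →
         ∃[ M ] M ⊆ P × Matching M × length P ≤ 2 * q * length M
    go []         _        _                _     = [] , [] , ([] , []) , z≤n
    go (e ∷ rest) (acc rs) (e-ok ∷ rest-ok) deg≤q
      with go (filterᵇ (disjointᵇ e) rest) (rs (s≤s (length-filter (T? ∘ disjointᵇ e) rest)))
              (All-resp-⊆ (filterᵇ-⊆ (disjointᵇ e) rest) rest-ok)
              (λ u → ≤-trans (degree-⊆ (e ∷ʳ filterᵇ-⊆ (disjointᵇ e) rest) u) (deg≤q u))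
    ... | M , M⊆rest′ , (M-ok , M-disjoint) , |rest′|≤ =
      e ∷ M , refl ∷ ⊆-trans M⊆rest′ (filterᵇ-⊆ (disjointᵇ e) rest) ,
      (e-ok ∷ M-ok , All-resp-⊆ M⊆rest′ rest′⊥e ∷ M-disjoint) ,
      greedy-count (length-≤-filterᵇ-cover (touches (proj₁ e)) (touches (proj₂ e)) rest) |rest′|≤
        (subst (_≤ q) (degree-endpoint e rest (touches-proj₁ e)) (deg≤q (proj₁ e)))
        (subst (_≤ q) (degree-endpoint e rest (touches-proj₂ e)) (deg≤q (proj₂ e)))
      where
      rest′⊥e : All (Disjoint e) (filterᵇ (disjointᵇ e) rest)
      rest′⊥e = All.map (disjointᵇ⇒Disjoint e _) (all-filter (T? ∘ disjointᵇ e) rest)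

module ExponentArithmetic where

  open import Data.Nat.Base using (zero; suc; _+_; _*_; _∸_; _≤_; s≤s)
  open import Data.Nat.Properties
  open import Data.Nat.Tactic.RingSolver using (solve-∀)
  open import Relation.Binary.PropositionalEquality

  r²n[n∸1]≤2n²r[r∸1] : ∀ n r → 2 ≤ r → r * r * (n * (n ∸ 1)) ≤ 2 * (n * n) * (r * (r ∸ 1))
  r²n[n∸1]≤2n²r[r∸1] zero    r             _             = ≤-reflexive (*-zeroʳ (r * r))
  r²n[n∸1]≤2n²r[r∸1] (suc n) (suc (suc r)) (s≤s (s≤s _)) = begin
    (2 + r) * (2 + r) * (suc n * n)             ≡⟨ split-left n r ⟩
    ((2 + r) * suc n) * ((2 + r) * n)           ≤⟨ *-monoʳ-≤ ((2 + r) * suc n) (m≤m+n ((2 + r) * n) (2 + 2 * r + n * r)) ⟩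
    ((2 + r) * suc n) * ((2 + r) * n + (2 + 2 * r + n * r)) ≡⟨ split-right n r ⟩
    2 * (suc n * suc n) * ((2 + r) * suc r)     ∎
    where
    open ≤-Reasoning
    split-left : ∀ n r → (2 + r) * (2 + r) * (suc n * n) ≡ ((2 + r) * suc n) * ((2 + r) * n)
    split-left = solve-∀
    split-right : ∀ n r → ((2 + r) * suc n) * ((2 + r) * n + (2 + 2 * r + n * r)) ≡ 2 * (suc n * suc n) * ((2 + r) * suc r)
    split-right = solve-∀

  -- the two factors 2 in 4q: |P| ≤ 2q·m from the greedy matching, and r²/n² ≤ 2·r(r − 1)/(n(n − 1))
  exponent-bound : ∀ {p} q m n r → p ≤ 2 * q * m → 2 ≤ r →
                   p * r * r * (n * (n ∸ 1)) ≤ m * (r * (r ∸ 1)) * (4 * q * n * n)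
  exponent-bound {p} q m n r p≤2qm 2≤r = begin
    p * r * r * (n * (n ∸ 1))              ≤⟨ *-monoˡ-≤ (n * (n ∸ 1)) (*-monoˡ-≤ r (*-monoˡ-≤ r p≤2qm)) ⟩
    2 * q * m * r * r * (n * (n ∸ 1))      ≡⟨ regroup q m r (n * (n ∸ 1)) ⟩
    2 * q * m * (r * r * (n * (n ∸ 1)))    ≤⟨ *-monoʳ-≤ (2 * q * m) (r²n[n∸1]≤2n²r[r∸1] n r 2≤r) ⟩
    2 * q * m * (2 * (n * n) * (r * (r ∸ 1))) ≡⟨ regroup′ q m n (r * (r ∸ 1)) ⟩
    m * (r * (r ∸ 1)) * (4 * q * n * n)    ∎
    where
    open ≤-Reasoning
    regroup : ∀ q m r d → 2 * q * m * r * r * d ≡ 2 * q * m * (r * r * d)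
    regroup = solve-∀
    regroup′ : ∀ q m n c → 2 * q * m * (2 * (n * n) * c) ≡ m * c * (4 * q * n * n)
    regroup′ = solve-∀

open import Data.Nat using (ℕ; _*_)
open import Data.Fin using (Fin; toℕ)
open import Data.Product using (_×_; proj₁; proj₂)
open import Data.List using (List; length; filterᵇ)
open import Data.List.Relation.Unary.All using (All)
open import Data.List.Relation.Unary.Unique.Propositional using (Unique)
open import Data.Rational using (_≤_; 1ℚ) renaming (_*_ to _*ℚ_)
import Data.Nat as N

open import Data.Nat.Properties using (≤-trans; *-mono-≤; ∸-monoˡ-≤; <⇒≢)
open import Data.Product using (_,_)
open import Relation.Binary.PropositionalEquality using (cong; subst; sym)
import Data.List.Relation.Unary.All as All
open TruncatedExponential using (frac-*-expPartial≤1)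
open SubsetCounting using (count-true>0; length-rSubsets)
open Matchings using (greedy-matching; avoiding-rSubsets-bound)
open ExponentArithmetic using (exponent-bound)

proposition3p4 : (n q : ℕ) (P : List (Fin n × Fin n)) →
    All (λ p → toℕ (proj₁ p) N.< toℕ (proj₂ p)) P →
    Unique P →
    (∀ u → degree P u N.≤ q) →
    1 N.≤ q →
    (r : ℕ) → 2 N.≤ r → r N.≤ n →
    ∀ (M : ℕ) →
      frac (length (filterᵇ (avoids P) (rSubsets n r))) (length (rSubsets n r))
        *ℚ expPartial (frac (length P * r * r) (4 * q * n * n)) M
      ≤ 1ℚ
proposition3p4 n q P ordered _ degree≤q 1≤q r 2≤r r≤n M
  with greedy-matching P (All.map (λ p₁<p₂ p₁≡p₂ → <⇒≢ p₁<p₂ (cong toℕ p₁≡p₂)) ordered) degree≤q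
... | matching , matching⊆P , is-matching , |P|≤2q|matching| =
  frac-*-expPartial≤1 (length matching) M 0<binom 0<4qn² 0<n[n∸1] r[r∸1]≤n[n∸1]
    (avoiding-rSubsets-bound r matching⊆P is-matching) (exponent-bound q (length matching) n r |P|≤2q|matching| 2≤r)
  where
  2≤n : 2 N.≤ n
  2≤n = ≤-trans 2≤r r≤n
  0<n : 0 N.< n
  0<n = ≤-trans (N.s≤s N.z≤n) 2≤n
  0<binom : 0 N.< length (rSubsets n r)
  0<binom = subst (0 N.<_) (sym (length-rSubsets n r)) (count-true>0 r r≤n)
  0<4qn² : 0 N.< 4 * q * n * n
  0<4qn² = *-mono-≤ (*-mono-≤ (*-mono-≤ {1} {4} (N.s≤s N.z≤n) 1≤q) 0<n) 0<n
  0<n[n∸1] : 0 N.< n * (n N.∸ 1)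
  0<n[n∸1] = *-mono-≤ 0<n (∸-monoˡ-≤ 1 2≤n)
  r[r∸1]≤n[n∸1] : r * (r N.∸ 1) N.≤ n * (n N.∸ 1)
  r[r∸1]≤n[n∸1] = *-mono-≤ r≤n (∸-monoˡ-≤ 1 r≤n)
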